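{- Let $T_1^\infty$ be the doubly infinite comb: the tree consisting of a two-way infinite path $(\dots,x_{ -1},x_0,x_1,\dots)$ together with, for each $i\in\mathbb{Z}$, a new leaf $y_i$ adjacent only to $x_i$. Then $T_1^\infty$ is a locally finite, $\hat{T}$-free tree with $\zeta(T_1^\infty)=2$.
   Context: $\hat{T}$ is the finite tree on 10 vertices consisting of a root $r$ with three children $a,b,c$, each of which has exactly two children that are leaves. A graph is $H$-free if it does not contain $H$ as an induced subgraph. The Localization game on a graph $G$ with $k$ cops: the robber moves first, occupying a vertex; in each later robber move the robber moves to a neighboring vertex or stays put. On each cop move, the cops choose vertices $u_1,\dots,u_k$ (arbitrary) and learn the distances $d_i$ from each $u_i$ to the robber's current vertex. The cops capture the robber if after finitely many rounds they can determine the robber's vertex uniquely; otherwise the robber wins. The robber is omniscient. The localization number $\zeta(G)$ is the smallest cardinal $k$ such that $k$ cops have a winning strategy. -}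

module Defs where

open import Data.Nat using (ℕ; zero; suc; _<_; _≤_)
open import Data.Integer using (ℤ) renaming (suc to sucℤ)
open import Data.Bool using (Bool; true; false)
open import Data.Fin using (Fin; zero; suc; fromℕ; inject₁; #_)
open import Data.Vec using (Vec; lookup)
open import Data.List using (List)
open import Data.List.Membership.Propositional using (_∈_)
open import Data.Product using (_×_; _,_; Σ; ∃; ∃-syntax)
open import Data.Sum using (_⊎_)
open import Relation.Nullary using (¬_)
open import Relation.Binary.PropositionalEquality using (_≡_)
open import Function.Definitions using (Injective)

record Graph : Set₁ where
  field
    V   : Set
    Adj : V → V → Set
open Graph public

_⇔'_ : Set → Set → Set
A ⇔' B = (A → B) × (B → A)

module _ (G : Graph) where

  Walk : V G → V G → ℕ → Set
  Walk u v n = Σ (Fin (suc n) → V G) λ w →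
    (w zero ≡ u) × (w (fromℕ n) ≡ v) × (∀ (i : Fin n) → Adj G (w (inject₁ i)) (w (suc i)))

  Dist : V G → V G → ℕ → Set
  Dist u v n = Walk u v n × (∀ m → Walk u v m → n ≤ m)

  -- d(u,v) = d(u,w) (as elements of ℕ ∪ {∞})
  SameDist : V G → V G → V G → Set
  SameDist u v w = ∀ n → Dist u v n ⇔' Dist u w n

  Connected : Set
  Connected = ∀ u v → ∃[ n ] Walk u v n

  -- no cycle: no path p₀ … pₙ (distinct vertices, n ≥ 2) with pₙ adjacent to p₀
  Acyclic : Set
  Acyclic = ∀ n (p : Fin (suc (suc (suc n))) → V G) → Injective _≡_ _≡_ p →
    (∀ (i : Fin (suc (suc n))) → Adj G (p (inject₁ i)) (p (suc i))) →
    ¬ Adj G (p (fromℕ (suc (suc n)))) (p zero)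

  IsTree : Set
  IsTree = Connected × Acyclic

  LocallyFinite : Set
  LocallyFinite = ∀ v → Σ (List (V G)) λ xs → ∀ u → Adj G v u → u ∈ xs

  InducedSubgraph : Graph → Set
  InducedSubgraph H = Σ (V H → V G) λ f → Injective _≡_ _≡_ f ×
    (∀ a b → Adj H a b ⇔' Adj G (f a) (f b))

  Free : Graph → Set
  Free H = ¬ InducedSubgraph H

  -- Localization game.
  -- Robber trajectory: r t is the robber's vertex in round t (r 0 = initial
  -- vertex); each step stays put or moves to a neighbour.
  Trajectory : (ℕ → V G) → Set
  Trajectory r = ∀ t → (r (suc t) ≡ r t) ⊎ Adj G (r t) (r (suc t))

  -- A k-cop strategy is presented as a map from robber trajectories to the
  -- probe vectors of each round; it must only depend on information the cops
  -- have (the answers of earlier rounds).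
  Strategy : ℕ → Set
  Strategy k = (ℕ → V G) → ℕ → Vec (V G) k

  Indist : ∀ {k} → Strategy k → (ℕ → V G) → (ℕ → V G) → ℕ → Set
  Indist σ r r' t = ∀ s → s < t → ∀ i → SameDist (lookup (σ r s) i) (r s) (r' s)

  Admissible : ∀ {k} → Strategy k → Set
  Admissible σ = ∀ r r' → Trajectory r → Trajectory r' → ∀ t →
    Indist σ r r' t → σ r t ≡ σ r' t

  -- after the answers of round t, the robber's vertex r t is uniquely determined
  CapturedAt : ∀ {k} → Strategy k → (ℕ → V G) → ℕ → Set
  CapturedAt σ r t = ∀ r' → Trajectory r' → Indist σ r r' (suc t) → r' t ≡ r t

  CopsWin : ℕ → Set
  CopsWin k = Σ (Strategy k) λ σ → Admissible σ ×
    (∀ r → Trajectory r → ∃[ t ] CapturedAt σ r t)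

  LocalizationNumberIs : ℕ → Set
  LocalizationNumberIs k = CopsWin k × (∀ j → j < k → ¬ CopsWin j)

data TEdge : Fin 10 → Fin 10 → Set where
  r-a : TEdge (# 0) (# 1)
  r-b : TEdge (# 0) (# 2)
  r-c : TEdge (# 0) (# 3)
  a-1 : TEdge (# 1) (# 4)
  a-2 : TEdge (# 1) (# 5)
  b-1 : TEdge (# 2) (# 6)
  b-2 : TEdge (# 2) (# 7)
  c-1 : TEdge (# 3) (# 8)
  c-2 : TEdge (# 3) (# 9)

That : Graph
That = record { V = Fin 10 ; Adj = λ a b → TEdge a b ⊎ TEdge b a }

-- The doubly infinite comb: x_i = (i , false), y_i = (i , true).
data CombAdj : ℤ × Bool → ℤ × Bool → Set where
  spine→ : ∀ i → CombAdj (i , false) (sucℤ i , false)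
  spine← : ∀ i → CombAdj (sucℤ i , false) (i , false)
  leg→   : ∀ i → CombAdj (i , false) (i , true)
  leg←   : ∀ i → CombAdj (i , true) (i , false)

Comb : Graph
Comb = record { V = ℤ × Bool ; Adj = CombAdj }

module Submission where

-- Distances in the comb are explicit: ∣k − i∣ along the spine plus one for each leg endpoint (0 between
-- equal legs). Every vertex of a cycle, and every non-leaf of an embedded T̂, has two distinct neighbours,
-- so it lies on the spine; but a spine vertex has only two spine neighbours and a non-backtracking walk
-- along the spine is monotone, which rules out both.
-- Two cops win: a first probe at x₀ (distance d) confines the robber after his next move to positions
-- in [−n, n] with n = d + 1; probes at x₋ₙ and xₙ then return distances summing to 2n on the spine and
-- 2n + 2 on a leg, and the first distance fixes the position. One cop loses: from a spine vertex the
-- robber always has two distinct neighbours equidistant from the coming probe, one of them on the spine,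
-- so he moves to that one and the other yields an indistinguishable run.

open import Defs
open import Data.Bool using (Bool; true; false)
open import Data.Empty using (⊥-elim)
open import Data.Fin using (Fin; zero; suc; fromℕ<; toℕ; #_)
import Data.Fin.Properties as FinP
open import Data.Integer as ℤ using (ℤ; _+_; +_; -[1+_]; +[1+_]; -_; _-_; ∣_∣; +0; 1ℤ; -1ℤ; sign; _◃_)
import Data.Integer.Properties as ℤP
open import Algebra.Bundles using (AbelianGroup)
open import Algebra.Properties.Group (AbelianGroup.group ℤP.+-0-abelianGroup) using (∙-cancelˡ; ∙-cancelʳ)
open import Data.Integer.Tactic.RingSolver using (solve-∀)
open import Data.List using (List; []; _∷_)
open import Data.List.Relation.Unary.Any using (here; there)
open import Data.List.Membership.Propositional using (_∈_)
open import Data.Nat as ℕ using (ℕ; zero; suc; _≤_; _<_; z≤n; s≤s; z<s)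
open import Data.Nat.Properties as ℕP using (≤-refl; ≤-trans; ≤-reflexive; n≤1+n; +-suc)
open import Data.Product using (Σ; _×_; _,_; proj₁; proj₂)
open import Data.Sign as Sign using (Sign)
open import Data.Sum using (_⊎_; inj₁; inj₂; [_,_])
open import Data.Vec using (Vec; []; _∷_; lookup)
open import Function using (_∘_; id; case_of_)
open import Relation.Binary.Definitions using (tri<; tri≈; tri>)
open import Relation.Binary.PropositionalEquality hiding ([_])
open import Relation.Nullary using (¬_; yes; no; contradiction)

-- Walks and graph distance

module Walks (G : Graph) where

  []ʷ : ∀ {u} → Walk G u u 0
  []ʷ {u} = (λ _ → u) , refl , refl , λ ()

  infixr 5 _∷ʷ_
  _∷ʷ_ : ∀ {u w v n} → Adj G u w → Walk G w v n → Walk G u v (suc n)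
  _∷ʷ_ {u} e (w , w₀ , wₙ , steps) =
    (λ { zero → u ; (suc i) → w i }) , refl , wₙ ,
    λ { zero → subst (Adj G u) (sym w₀) e ; (suc i) → steps i }

  walk-bound : (φ : V G → ℕ) → (∀ {a b} → Adj G a b → φ b ≤ suc (φ a)) →
               ∀ {u v} m → Walk G u v m → φ v ≤ m ℕ.+ φ u
  walk-bound φ lip zero (w , w₀ , wₙ , _) = ≤-reflexive (cong φ (trans (sym wₙ) w₀))
  walk-bound φ lip {u} {v} (suc m) (w , w₀ , wₙ , steps) = begin
    φ v                 ≤⟨ walk-bound φ lip m ((w ∘ suc) , refl , wₙ , steps ∘ suc) ⟩
    m ℕ.+ φ (w (suc zero)) ≤⟨ ℕP.+-monoʳ-≤ m (lip (subst (λ a → Adj G a _) w₀ (steps zero))) ⟩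
    m ℕ.+ suc (φ u)     ≡⟨ +-suc m (φ u) ⟩
    suc m ℕ.+ φ u       ∎
    where open ℕP.≤-Reasoning

  SameDist-≡ : ∀ {u v w} → v ≡ w → SameDist G u v w
  SameDist-≡ refl n = id , id

  Move : V G → V G → Set
  Move a b = (b ≡ a) ⊎ Adj G a b

module ShortestPaths {G : Graph} (d : V G → V G → ℕ)
  (d-walk : ∀ u v → Walk G u v (d u v))
  (d-refl : ∀ v → d v v ≡ 0)
  (d-lipschitz : ∀ u {a b} → Adj G a b → d u b ≤ suc (d u a)) where

  open Walks G

  d-shortest : ∀ {u v} m → Walk G u v m → d u v ≤ m
  d-shortest {u} {v} m w = begin
    d u v          ≤⟨ walk-bound (d u) (d-lipschitz u) m w ⟩
    m ℕ.+ d u u    ≡⟨ cong (m ℕ.+_) (d-refl u) ⟩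
    m ℕ.+ 0        ≡⟨ ℕP.+-identityʳ m ⟩
    m              ∎
    where open ℕP.≤-Reasoning

  Dist-d : ∀ u v → Dist G u v (d u v)
  Dist-d u v = d-walk u v , d-shortest

  Dist⇒≡d : ∀ {u v n} → Dist G u v n → n ≡ d u v
  Dist⇒≡d (w , shortest) = ℕP.≤-antisym (shortest _ (d-walk _ _)) (d-shortest _ w)

  SameDist⇒≡ : ∀ {u v w} → SameDist G u v w → d u v ≡ d u w
  SameDist⇒≡ {u} {v} same = Dist⇒≡d (proj₁ (same (d u v)) (Dist-d u v))

  ≡⇒SameDist : ∀ {u v w} → d u v ≡ d u w → SameDist G u v w
  ≡⇒SameDist {u} {v} {w} e n =
    (λ D → subst (Dist G u w) (sym (trans (Dist⇒≡d D) e)) (Dist-d u w)) ,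
    (λ D → subst (Dist G u v) (sym (trans (Dist⇒≡d D) (sym e))) (Dist-d u v))

freezeAt : ∀ {A : Set} → (ℕ → A) → ℕ → A → ℕ → A
freezeAt f t z s with s ℕ.<? t
... | yes _ = f s
... | no _  = z

module _ {A : Set} {f : ℕ → A} {t : ℕ} {z : A} where

  freezeAt-< : ∀ {s} → s < t → freezeAt f t z s ≡ f s
  freezeAt-< {s} s<t with s ℕ.<? t
  ... | yes _  = refl
  ... | no s≮t = contradiction s<t s≮t

  freezeAt-≥ : ∀ {s} → t ≤ s → freezeAt f t z s ≡ z
  freezeAt-≥ {s} t≤s with s ℕ.<? t
  ... | yes s<t = contradiction t≤s (ℕP.<⇒≱ s<t)
  ... | no _    = refl

Trajectory-freezeAt : ∀ {G f t z} → Trajectory G f → (∀ s → suc s ≡ t → Walks.Move G (f s) z) →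
                      Trajectory G (freezeAt f t z)
Trajectory-freezeAt {G} {f} {t} {z} moves boundary s with ℕP.<-cmp (suc s) t
... | tri< s+1<t _ _ =
  subst₂ (Walks.Move G) (sym (freezeAt-< (ℕP.<-trans (ℕP.n<1+n s) s+1<t))) (sym (freezeAt-< s+1<t)) (moves s)
... | tri≈ _ s+1≡t _ =
  subst₂ (Walks.Move G) (sym (freezeAt-< (subst (s <_) s+1≡t (ℕP.n<1+n s))))
    (sym (freezeAt-≥ (ℕP.≤-reflexive (sym s+1≡t)))) (boundary s s+1≡t)
... | tri> _ _ t<s+1 =
  inj₁ (trans (freezeAt-≥ (ℕP.m≤n⇒m≤1+n (ℕP.≤-pred t<s+1))) (sym (freezeAt-≥ (ℕP.≤-pred t<s+1))))

clamp : ∀ N → ℕ → Fin (suc N)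
clamp N       zero    = zero
clamp zero    (suc m) = zero
clamp (suc N) (suc m) = suc (clamp N m)

toℕ-clamp : ∀ {N m} → m ≤ N → toℕ (clamp N m) ≡ m
toℕ-clamp {N}     {zero}  _       = refl
toℕ-clamp {suc N} {suc m} (s≤s h) = cong suc (toℕ-clamp h)

acyclic-fromℕ : ∀ {G} →
  (∀ n (q : ℕ → V G) → (∀ i → i < suc (suc n) → Adj G (q i) (q (suc i))) →
     (∀ {i k} → i ≤ suc (suc n) → k ≤ suc (suc n) → q i ≡ q k → i ≡ k) →
     ¬ Adj G (q (suc (suc n))) (q 0)) →
  Acyclic G
acyclic-fromℕ {G} no-cycle n p p-inj p-adj closing =
  no-cycle n q q-adj q-inj (subst (λ a → Adj G (p a) (p zero)) (clamp-at (FinP.toℕ-fromℕ N) ≤-refl) closing)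
  where
  N = suc (suc n)
  q : ℕ → V G
  q m = p (clamp N m)
  clamp-at : ∀ {j : Fin (suc N)} {m} → toℕ j ≡ m → m ≤ N → j ≡ clamp N m
  clamp-at e h = FinP.toℕ-injective (trans e (sym (toℕ-clamp h)))
  q-adj : ∀ i → i < N → Adj G (q i) (q (suc i))
  q-adj i h = subst₂ (λ a b → Adj G (p a) (p b))
    (clamp-at (trans (FinP.toℕ-inject₁ (fromℕ< h)) (FinP.toℕ-fromℕ< h)) (ℕP.<⇒≤ h))
    (clamp-at (cong suc (FinP.toℕ-fromℕ< h)) h)
    (p-adj (fromℕ< h))
  q-inj : ∀ {i k} → i ≤ N → k ≤ N → q i ≡ q k → i ≡ k
  q-inj hi hk e = trans (sym (toℕ-clamp hi)) (trans (cong toℕ (p-inj e)) (toℕ-clamp hk))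

-- Non-backtracking walks on ℤ

◃-suc : ∀ s n → (s ◃ suc n) ≡ (s ◃ 1) + (s ◃ n)
◃-suc Sign.+ zero    = refl
◃-suc Sign.+ (suc n) = refl
◃-suc Sign.- zero    = refl
◃-suc Sign.- (suc n) = refl

∣x∣≡∣y∣-if-closed : ∀ a x y → a ≡ y + (x + a) → ∣ x ∣ ≡ ∣ y ∣
∣x∣≡∣y∣-if-closed a x y closed = begin
  ∣ x ∣                       ≡⟨ cong ∣_∣ (split a x y) ⟩
  ∣ - y + ((y + (x + a)) - a) ∣ ≡⟨ cong (λ z → ∣ - y + (z - a) ∣) (sym closed) ⟩
  ∣ - y + (a - a) ∣           ≡⟨ cong (λ z → ∣ - y + z ∣) (ℤP.+-inverseʳ a) ⟩
  ∣ - y + +0 ∣                ≡⟨ cong ∣_∣ (ℤP.+-identityʳ (- y)) ⟩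
  ∣ - y ∣                     ≡⟨ ℤP.∣-i∣≡∣i∣ y ⟩
  ∣ y ∣                       ∎
  where
  open ≡-Reasoning
  split : ∀ a x y → x ≡ - y + ((y + (x + a)) - a)
  split = solve-∀

same-sign : ∀ s t {a b c} → b ≡ (s ◃ 1) + a → c ≡ (t ◃ 1) + b → c ≢ a → t ≡ s
same-sign Sign.+ Sign.+ _ _ _ = refl
same-sign Sign.- Sign.- _ _ _ = refl
same-sign Sign.+ Sign.- {a} refl refl c≢a = ⊥-elim (c≢a (back a))
  where back : ∀ a → -1ℤ + (1ℤ + a) ≡ a
        back = solve-∀
same-sign Sign.- Sign.+ {a} refl refl c≢a = ⊥-elim (c≢a (back a))
  where back : ∀ a → 1ℤ + (-1ℤ + a) ≡ a
        back = solve-∀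

module _ (c : ℕ → ℤ) {N : ℕ}
  (step : ∀ i → i < N → Σ Sign λ s → c (suc i) ≡ (s ◃ 1) + c i)
  (no-return : ∀ i → suc (suc i) ≤ N → c (suc (suc i)) ≢ c i) where

  nonBacktracking-steady : ∀ s → c 1 ≡ (s ◃ 1) + c 0 → ∀ i → i < N → c (suc i) ≡ (s ◃ 1) + c i
  nonBacktracking-steady s first zero    _ = first
  nonBacktracking-steady s first (suc i) h with step (suc i) h
  ... | t , next = subst (λ t → c (suc (suc i)) ≡ (t ◃ 1) + c (suc i))
                     (same-sign s t previous next (no-return i h)) next
    where previous = nonBacktracking-steady s first i (ℕP.<-trans (ℕP.n<1+n i) h)

  nonBacktracking-straight : ∀ s → c 1 ≡ (s ◃ 1) + c 0 → ∀ i → i ≤ N → c i ≡ (s ◃ i) + c 0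
  nonBacktracking-straight s first zero    _ = sym (ℤP.+-identityˡ (c 0))
  nonBacktracking-straight s first (suc i) h = begin
    c (suc i)                 ≡⟨ nonBacktracking-steady s first i h ⟩
    (s ◃ 1) + c i             ≡⟨ cong (λ z → (s ◃ 1) + z) (nonBacktracking-straight s first i (ℕP.<⇒≤ h)) ⟩
    (s ◃ 1) + ((s ◃ i) + c 0) ≡⟨ ℤP.+-assoc (s ◃ 1) (s ◃ i) (c 0) ⟨
    ((s ◃ 1) + (s ◃ i)) + c 0 ≡⟨ cong (_+ c 0) (◃-suc s i) ⟨
    (s ◃ suc i) + c 0         ∎
    where open ≡-Reasoning

nonBacktracking-not-closed : ∀ (c : ℕ → ℤ) n →
  (∀ i → i < suc (suc n) → Σ Sign λ s → c (suc i) ≡ (s ◃ 1) + c i) →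
  (∀ i → suc (suc i) ≤ suc (suc n) → c (suc (suc i)) ≢ c i) →
  ¬ (Σ Sign λ t → c 0 ≡ (t ◃ 1) + c (suc (suc n)))
nonBacktracking-not-closed c n step no-return (t , closing) with step 0 z<s
... | s , first with ∣x∣≡∣y∣-if-closed (c 0) (s ◃ suc (suc n)) (t ◃ 1)
                      (trans closing (cong (λ z → (t ◃ 1) + z) (nonBacktracking-straight c step no-return s first _ ≤-refl)))
... | length≡1 with trans (sym (ℤP.abs-◃ s (suc (suc n)))) (trans length≡1 (ℤP.abs-◃ t 1))
... | ()

-- The comb

open Walks Comb

legs : Bool → ℕ
legs false = 0
legs true  = 1

distBy : Bool → Bool → ℤ → ℕ
distBy false b     δ        = legs b ℕ.+ ∣ δ ∣
distBy true  false δ        = suc ∣ δ ∣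
distBy true  true  (+ zero) = 0
distBy true  true  δ        = suc (suc ∣ δ ∣)

dist : V Comb → V Comb → ℕ
dist (i , b) (k , b') = distBy b b' (k - i)

dist-refl : ∀ v → dist v v ≡ 0
dist-refl (i , b) rewrite ℤP.+-inverseʳ i with b
... | false = refl
... | true  = refl

distBy-shift : ∀ l x δ → distBy l false (x + δ) ≤ ∣ x ∣ ℕ.+ distBy l false δ
distBy-shift false x δ = ℤP.∣i+j∣≤∣i∣+∣j∣ x δ
distBy-shift true  x δ = ≤-trans (s≤s (ℤP.∣i+j∣≤∣i∣+∣j∣ x δ)) (≤-reflexive (sym (+-suc ∣ x ∣ ∣ δ ∣)))

distBy-onto-leg : ∀ l δ → distBy l true δ ≤ suc (distBy l false δ)
distBy-onto-leg false δ        = ≤-refl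
distBy-onto-leg true  (+ zero) = z≤n
distBy-onto-leg true  +[1+ n ] = ≤-refl
distBy-onto-leg true  -[1+ n ] = ≤-refl

distBy-off-leg : ∀ l δ → distBy l false δ ≤ suc (distBy l true δ)
distBy-off-leg false δ        = ℕP.m≤n+m ∣ δ ∣ 2
distBy-off-leg true  (+ zero) = s≤s z≤n
distBy-off-leg true  +[1+ n ] = ℕP.m≤n+m _ 2
distBy-off-leg true  -[1+ n ] = ℕP.m≤n+m _ 2

dist-lipschitz : ∀ u {a b} → CombAdj a b → dist u b ≤ suc (dist u a)
dist-lipschitz (i , l) (spine→ k) =
  subst (λ δ → distBy l false δ ≤ suc (distBy l false (k - i))) (sym (forward k i)) (distBy-shift l 1ℤ (k - i))
  where forward : ∀ k i → (1ℤ + k) - i ≡ 1ℤ + (k - i)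
        forward = solve-∀
dist-lipschitz (i , l) (spine← k) =
  subst (λ δ → distBy l false δ ≤ suc (distBy l false ((1ℤ + k) - i))) (sym (backward k i)) (distBy-shift l -1ℤ ((1ℤ + k) - i))
  where backward : ∀ k i → k - i ≡ -1ℤ + ((1ℤ + k) - i)
        backward = solve-∀
dist-lipschitz (i , l) (leg→ k) = distBy-onto-leg l (k - i)
dist-lipschitz (i , l) (leg← k) = distBy-off-leg l (k - i)

spine-edge : ∀ s k → CombAdj (k , false) ((s ◃ 1) + k , false)
spine-edge Sign.+ k = spine→ k
spine-edge Sign.- k = subst (λ j → CombAdj (j , false) (ℤ.pred k , false)) (ℤP.suc-pred k) (spine← (ℤ.pred k))

spine-walk : ∀ s n k {v m} → Walk Comb ((s ◃ n) + k , false) v m → Walk Comb (k , false) v (n ℕ.+ m)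
spine-walk s zero    k {v} {m} w = subst (λ j → Walk Comb (j , false) v m) (ℤP.+-identityˡ k) w
spine-walk s (suc n) k {v} {m} w =
  spine-edge s k ∷ʷ spine-walk s n ((s ◃ 1) + k) (subst (λ j → Walk Comb (j , false) v m) regroup w)
  where
  regroup : (s ◃ suc n) + k ≡ (s ◃ n) + ((s ◃ 1) + k)
  regroup = begin
    (s ◃ suc n) + k             ≡⟨ cong (_+ k) (◃-suc s n) ⟩
    ((s ◃ 1) + (s ◃ n)) + k     ≡⟨ cong (_+ k) (ℤP.+-comm (s ◃ 1) (s ◃ n)) ⟩
    ((s ◃ n) + (s ◃ 1)) + k     ≡⟨ ℤP.+-assoc (s ◃ n) (s ◃ 1) k ⟩
    (s ◃ n) + ((s ◃ 1) + k)     ∎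
    where open ≡-Reasoning

spine-walk-to : ∀ i k {v m} → Walk Comb (k , false) v m → Walk Comb (i , false) v (∣ k - i ∣ ℕ.+ m)
spine-walk-to i k {v} {m} w = spine-walk (sign (k - i)) ∣ k - i ∣ i (subst (λ j → Walk Comb (j , false) v m) (sym arrive) w)
  where
  arrive : (sign (k - i) ◃ ∣ k - i ∣) + i ≡ k
  arrive = trans (cong (_+ i) (ℤP.◃-inverse (k - i))) (cancel k i)
    where cancel : ∀ k i → (k - i) + i ≡ k
          cancel = solve-∀

leg-to-leg : ∀ i k → Walk Comb (i , true) (k , true) (suc (suc ∣ k - i ∣))
leg-to-leg i k = leg← i ∷ʷ subst (Walk Comb _ _) (ℕP.+-comm _ 1) (spine-walk-to i k (leg→ k ∷ʷ []ʷ))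

dist-walk : ∀ u v → Walk Comb u v (dist u v)
dist-walk (i , false) (k , false) = subst (Walk Comb _ _) (ℕP.+-identityʳ _) (spine-walk-to i k []ʷ)
dist-walk (i , false) (k , true)  = subst (Walk Comb _ _) (ℕP.+-comm _ 1) (spine-walk-to i k (leg→ k ∷ʷ []ʷ))
dist-walk (i , true)  (k , false) = leg← i ∷ʷ subst (Walk Comb _ _) (ℕP.+-identityʳ _) (spine-walk-to i k []ʷ)
dist-walk (i , true)  (k , true) with k - i in offset
... | + zero   = subst (λ j → Walk Comb (i , true) (j , true) 0) (sym (ℤP.i-j≡0⇒i≡j k i offset)) []ʷ
... | +[1+ n ] = subst (Walk Comb _ _) (cong (λ δ → suc (suc ∣ δ ∣)) offset) (leg-to-leg i k)
... | -[1+ n ] = subst (Walk Comb _ _) (cong (λ δ → suc (suc ∣ δ ∣)) offset) (leg-to-leg i k)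

open ShortestPaths dist dist-walk dist-refl dist-lipschitz

neighbours : V Comb → List (V Comb)
neighbours (i , _) = (1ℤ + i , false) ∷ (-1ℤ + i , false) ∷ (i , true) ∷ (i , false) ∷ []

comb-locallyFinite : LocallyFinite Comb
comb-locallyFinite v = neighbours v , λ _ → listed
  where
  listed : ∀ {v u} → CombAdj v u → u ∈ neighbours v
  listed (spine→ i) = here refl
  listed (spine← i) = there (here (cong (_, false) (sym (ℤP.pred-suc i))))
  listed (leg→ i)   = there (there (here refl))
  listed (leg← i)   = there (there (there (here refl)))

CombAdj-sym : ∀ {a b} → CombAdj a b → CombAdj b a
CombAdj-sym (spine→ i) = spine← i
CombAdj-sym (spine← i) = spine→ i
CombAdj-sym (leg→ i)   = leg← i
CombAdj-sym (leg← i)   = leg→ i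

leg-neighbour : ∀ {i w} → CombAdj (i , true) w → w ≡ (i , false)
leg-neighbour (leg← i) = refl

two-neighbours⇒spine : ∀ {v a b} → CombAdj v a → CombAdj v b → a ≢ b → proj₂ v ≡ false
two-neighbours⇒spine {i , false} _    _    _   = refl
two-neighbours⇒spine {i , true}  va vb a≢b = ⊥-elim (a≢b (trans (leg-neighbour va) (sym (leg-neighbour vb))))

spine-step : ∀ {u w} → CombAdj u w → proj₂ u ≡ false → proj₂ w ≡ false →
             Σ Sign λ s → proj₁ w ≡ (s ◃ 1) + proj₁ u
spine-step (spine→ i) _ _ = Sign.+ , refl
spine-step (spine← i) _ _ = Sign.- , sym (ℤP.pred-suc i)
spine-step (leg→ i)   _ ()
spine-step (leg← i)   () _

spine-≡ : ∀ (u w : V Comb) → proj₂ u ≡ false → proj₂ w ≡ false → proj₁ u ≡ proj₁ w → u ≡ w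
spine-≡ (i , false) (.i , false) refl refl refl = refl

sign-pigeonhole : ∀ (s t r : Sign) → s ≡ t ⊎ s ≡ r ⊎ t ≡ r
sign-pigeonhole Sign.+ Sign.+ _      = inj₁ refl
sign-pigeonhole Sign.- Sign.- _      = inj₁ refl
sign-pigeonhole Sign.+ Sign.- Sign.+ = inj₂ (inj₁ refl)
sign-pigeonhole Sign.+ Sign.- Sign.- = inj₂ (inj₂ refl)
sign-pigeonhole Sign.- Sign.+ Sign.+ = inj₂ (inj₂ refl)
sign-pigeonhole Sign.- Sign.+ Sign.- = inj₂ (inj₁ refl)

at-most-two-spine-neighbours : ∀ {v a b c} → proj₂ v ≡ false →
  CombAdj v a → proj₂ a ≡ false → CombAdj v b → proj₂ b ≡ false → CombAdj v c → proj₂ c ≡ false →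
  a ≡ b ⊎ a ≡ c ⊎ b ≡ c
at-most-two-spine-neighbours {v} {a} {b} {c} v-spine va a-spine vb b-spine vc c-spine
  with spine-step va v-spine a-spine | spine-step vb v-spine b-spine | spine-step vc v-spine c-spine
... | s , ea | t , eb | r , ec with sign-pigeonhole s t r
... | inj₁ refl        = inj₁ (spine-≡ a b a-spine b-spine (trans ea (sym eb)))
... | inj₂ (inj₁ refl) = inj₂ (inj₁ (spine-≡ a c a-spine c-spine (trans ea (sym ec))))
... | inj₂ (inj₂ refl) = inj₂ (inj₂ (spine-≡ b c b-spine c-spine (trans eb (sym ec))))

comb-acyclic : Acyclic Comb
comb-acyclic = acyclic-fromℕ {Comb} no-cycle
  where
  no-cycle : ∀ n (q : ℕ → V Comb) → (∀ i → i < suc (suc n) → CombAdj (q i) (q (suc i))) →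
     (∀ {i k} → i ≤ suc (suc n) → k ≤ suc (suc n) → q i ≡ q k → i ≡ k) →
     ¬ CombAdj (q (suc (suc n))) (q 0)
  no-cycle n q adj inj closing = nonBacktracking-not-closed (proj₁ ∘ q) n step no-return
                                   (spine-step closing (on-spine N ≤-refl) (on-spine 0 z≤n))
    where
    N = suc (suc n)
    distinct : ∀ {i k} → i ≤ N → k ≤ N → i ≢ k → q i ≢ q k
    distinct hi hk i≢k e = i≢k (inj hi hk e)
    on-spine : ∀ i → i ≤ N → proj₂ (q i) ≡ false
    on-spine zero    _ = two-neighbours⇒spine (adj 0 z<s) (CombAdj-sym closing) (distinct (s≤s z≤n) ≤-refl λ ())
    on-spine (suc j) h with ℕP.m≤n⇒m<n∨m≡n h
    ... | inj₁ j+1<N = two-neighbours⇒spine (CombAdj-sym (adj j (ℕP.<-trans (ℕP.n<1+n j) j+1<N))) (adj (suc j) j+1<N)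
                         (distinct (ℕP.<⇒≤ (ℕP.<-trans (ℕP.n<1+n j) j+1<N)) j+1<N (ℕP.<⇒≢ (ℕP.m<n⇒m<1+n (ℕP.n<1+n j))))
    ... | inj₂ refl = two-neighbours⇒spine (CombAdj-sym (adj (suc n) ≤-refl)) closing (distinct (n≤1+n _) z≤n λ ())
    step : ∀ i → i < N → Σ Sign λ s → proj₁ (q (suc i)) ≡ (s ◃ 1) + proj₁ (q i)
    step i h = spine-step (adj i h) (on-spine i (ℕP.<⇒≤ h)) (on-spine (suc i) h)
    no-return : ∀ i → suc (suc i) ≤ N → proj₁ (q (suc (suc i))) ≢ proj₁ (q i)
    no-return i h e = ℕP.<⇒≢ (ℕP.m<n⇒m<1+n (ℕP.n<1+n i)) (sym (inj h i≤N (spine-≡ (q (suc (suc i))) (q i) (on-spine _ h) (on-spine i i≤N) e)))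
      where i≤N = ℕP.≤-trans (n≤1+n i) (ℕP.≤-trans (n≤1+n _) h)

comb-T̂-free : Free Comb That
comb-T̂-free (f , f-inj , f-adj) =
  [ distinct {# 1} {# 2} (λ ()) , [ distinct {# 1} {# 3} (λ ()) , distinct {# 2} {# 3} (λ ()) ] ]
  (at-most-two-spine-neighbours root-spine
     (edge r-a) (child-spine r-a a-1 λ ()) (edge r-b) (child-spine r-b b-1 λ ()) (edge r-c) (child-spine r-c c-1 λ ()))
  where
  edge : ∀ {x y} → TEdge x y → CombAdj (f x) (f y)
  edge e = proj₁ (f-adj _ _) (inj₁ e)
  edge⁻ : ∀ {x y} → TEdge x y → CombAdj (f y) (f x)
  edge⁻ e = proj₁ (f-adj _ _) (inj₂ e)
  distinct : ∀ {x y} → x ≢ y → f x ≢ f y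
  distinct x≢y e = x≢y (f-inj e)
  root-spine : proj₂ (f (# 0)) ≡ false
  root-spine = two-neighbours⇒spine (edge r-a) (edge r-b) (distinct {# 1} {# 2} λ ())
  child-spine : ∀ {x y} → TEdge (# 0) x → TEdge x y → # 0 ≢ y → proj₂ (f x) ≡ false
  child-spine up down r≢y = two-neighbours⇒spine (edge⁻ up) (edge down) (distinct r≢y)

-- Two cops win

origin : V Comb
origin = (+0 , false)

∣position∣≤dist-origin : ∀ v → ∣ proj₁ v ∣ ≤ dist origin v
∣position∣≤dist-origin (k , b) = subst (λ δ → ∣ k ∣ ≤ distBy false b δ) (sym (ℤP.+-identityʳ k)) (ℕP.m≤n+m ∣ k ∣ (legs b))

move-lipschitz : ∀ u {a b} → Move a b → dist u b ≤ suc (dist u a)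
move-lipschitz u (inj₁ refl) = n≤1+n _
move-lipschitz u (inj₂ a~b)  = dist-lipschitz u a~b

straddle-+ : ∀ {m n} → m ≤ n → Σ ℕ λ a → Σ ℕ λ b →
             (+ n + + m ≡ + a) × (+ n - + m ≡ + b) × (a ℕ.+ b ≡ n ℕ.+ n)
straddle-+ {m} {n} m≤n = n ℕ.+ m , n ℕ.∸ m , refl , trans (ℤP.m-n≡m⊖n n m) (ℤP.⊖-≥ m≤n) ,
  trans (ℕP.+-assoc n m (n ℕ.∸ m)) (cong (n ℕ.+_) (ℕP.m+[n∸m]≡n m≤n))

straddle : ∀ {k n} → ∣ k ∣ ≤ n → Σ ℕ λ a → Σ ℕ λ b →
           (+ n + k ≡ + a) × (+ n - k ≡ + b) × (a ℕ.+ b ≡ n ℕ.+ n)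
straddle {+ m}      h = straddle-+ h
straddle { -[1+ m ]} h with straddle-+ h
... | a , b , e₊ , e₋ , sum = b , a , e₋ , e₊ , trans (ℕP.+-comm b a) sum

bracket-dists : ∀ {n} v → ∣ proj₁ v ∣ ≤ n → Σ ℕ λ a → Σ ℕ λ b → (+ n + proj₁ v ≡ + a) ×
  (dist (- + n , false) v ≡ legs (proj₂ v) ℕ.+ a) × (dist (+ n , false) v ≡ legs (proj₂ v) ℕ.+ b) × (a ℕ.+ b ≡ n ℕ.+ n)
bracket-dists {n} (k , β) h with straddle {k} h
... | a , b , e₊ , e₋ , sum = a , b , e₊ , cong (legs β ℕ.+_) from-left , cong (legs β ℕ.+_) from-right , sum
  where
  from-left : ∣ k - - + n ∣ ≡ a
  from-left = cong ∣_∣ (trans (left k (+ n)) e₊)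
    where left : ∀ k n → k - - n ≡ n + k
          left = solve-∀
  from-right : ∣ k - + n ∣ ≡ b
  from-right = trans (cong ∣_∣ (trans (right k (+ n)) (cong -_ e₋))) (ℤP.∣-i∣≡∣i∣ (+ b))
    where right : ∀ k n → k - n ≡ - (n - k)
          right = solve-∀

suc-+-suc≢ : ∀ a b → suc a ℕ.+ suc b ≢ a ℕ.+ b
suc-+-suc≢ a b e = ℕP.<⇒≢ smaller (sym e)
  where smaller : a ℕ.+ b < suc a ℕ.+ suc b
        smaller = subst (a ℕ.+ b <_) (cong suc (sym (+-suc a b))) (ℕP.m<n⇒m<1+n (ℕP.n<1+n _))

legs-separate : ∀ β β' {a b a' b' w} → a ℕ.+ b ≡ w → a' ℕ.+ b' ≡ w →
  legs β ℕ.+ a ≡ legs β' ℕ.+ a' → legs β ℕ.+ b ≡ legs β' ℕ.+ b' → β ≡ β' × a ≡ a'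
legs-separate false false _ _ ea _ = refl , ea
legs-separate true  true  _ _ ea _ = refl , ℕP.suc-injective ea
legs-separate false true {a' = a'} {b'} sum sum' ea eb =
  ⊥-elim (suc-+-suc≢ a' b' (trans (cong₂ ℕ._+_ (sym ea) (sym eb)) (trans sum (sym sum'))))
legs-separate true false {a} {b} sum sum' ea eb =
  ⊥-elim (suc-+-suc≢ a b (trans (cong₂ ℕ._+_ ea eb) (trans sum' (sym sum))))

bracket-separates : ∀ {n} u v → ∣ proj₁ u ∣ ≤ n → ∣ proj₁ v ∣ ≤ n →
  dist (- + n , false) u ≡ dist (- + n , false) v → dist (+ n , false) u ≡ dist (+ n , false) v → u ≡ v
bracket-separates {n} (k , β) (k' , β') hu hv eL eR with bracket-dists (k , β) hu | bracket-dists (k' , β') hv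
... | a , b , pos , dL , dR , sum | a' , b' , pos' , dL' , dR' , sum'
  with legs-separate β β' sum sum' (trans (sym dL) (trans eL dL')) (trans (sym dR) (trans eR dR'))
... | refl , refl = cong (_, β) (∙-cancelˡ (+ n) k k' (trans pos (sym pos')))

bracket : ℕ → Vec (V Comb) 2
bracket n = (- + n , false) ∷ (+ n , false) ∷ []

-- After one move the robber is within this distance of the origin.
reach : (ℕ → V Comb) → ℕ
reach r = suc (dist origin (r 0))

two-cop-strategy : Strategy Comb 2
two-cop-strategy r zero    = origin ∷ origin ∷ []
two-cop-strategy r (suc t) = bracket (reach r)

reach-agrees : ∀ {r r' t} → Indist Comb two-cop-strategy r r' (suc t) → reach r ≡ reach r'
reach-agrees same = cong suc (SameDist⇒≡ (same 0 z<s zero))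

two-cop-admissible : Admissible Comb two-cop-strategy
two-cop-admissible r r' _ _ zero    _    = refl
two-cop-admissible r r' _ _ (suc t) same = cong bracket (reach-agrees same)

within-reach : ∀ {r} → Trajectory Comb r → ∣ proj₁ (r 1) ∣ ≤ reach r
within-reach {r} moves = ≤-trans (∣position∣≤dist-origin (r 1)) (move-lipschitz origin (moves 0))

two-cops-capture : ∀ r → Trajectory Comb r → CapturedAt Comb two-cop-strategy r 1
two-cops-capture r moves r' moves' same =
  sym (bracket-separates (r 1) (r' 1) (within-reach moves)
        (subst (∣ proj₁ (r' 1) ∣ ≤_) (sym (reach-agrees same)) (within-reach moves'))
        (SameDist⇒≡ (same 1 ≤-refl zero)) (SameDist⇒≡ (same 1 ≤-refl (suc zero))))

two-cops-win : CopsWin Comb 2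
two-cops-win = two-cop-strategy , two-cop-admissible , λ r moves → 1 , two-cops-capture r moves

-- One cop loses

record Dodge (m : ℤ) (u : V Comb) : Set where
  field
    next        : ℤ
    twin        : V Comb
    next-adj    : CombAdj (m , false) (next , false)
    twin-adj    : CombAdj (m , false) twin
    twin≢next   : twin ≢ (next , false)
    equidistant : dist u (next , false) ≡ dist u twin

distBy-to-spine : ∀ l δ → distBy l false δ ≡ legs l ℕ.+ ∣ δ ∣
distBy-to-spine false δ = refl
distBy-to-spine true  δ = refl

dist-along-spine : ∀ j l x m → dist (j , l) (x + m , false) ≡ legs l ℕ.+ ∣ x + (m - j) ∣
dist-along-spine j l x m = trans (distBy-to-spine l _) (cong (λ δ → legs l ℕ.+ ∣ δ ∣) (regroup x m j))
  where regroup : ∀ x m j → (x + m) - j ≡ x + (m - j)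
        regroup = solve-∀

distBy-to-leg : ∀ l s n → distBy l true (s ◃ suc n) ≡ legs l ℕ.+ suc (suc n)
distBy-to-leg false Sign.+ n = refl
distBy-to-leg false Sign.- n = refl
distBy-to-leg true  Sign.+ n = refl
distBy-to-leg true  Sign.- n = refl

-- From x_m the robber can step away from the probe u either along the spine or onto its leg y_m;
-- if u is level with x_m, it steps to x_(m−1) or x_(m+1).
dodge : ∀ m u → Dodge m u
dodge m (j , l) with m - j in offset
... | + zero = record
  { next        = -1ℤ + m
  ; twin        = (1ℤ + m , false)
  ; next-adj    = spine-edge Sign.- m
  ; twin-adj    = spine→ m
  ; twin≢next   = λ e → case ∙-cancelʳ m 1ℤ -1ℤ (cong proj₁ e) of λ ()
  ; equidistant = trans (dist-along-spine j l -1ℤ m) (trans (cong (λ δ → legs l ℕ.+ ∣ -1ℤ + δ ∣) offset)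
                    (sym (trans (dist-along-spine j l 1ℤ m) (cong (λ δ → legs l ℕ.+ ∣ 1ℤ + δ ∣) offset))))
  }
... | +[1+ n ] = record
  { next        = 1ℤ + m
  ; twin        = (m , true)
  ; next-adj    = spine→ m
  ; twin-adj    = leg→ m
  ; twin≢next   = λ e → case cong proj₂ e of λ ()
  ; equidistant = trans (dist-along-spine j l 1ℤ m) (trans (cong (λ δ → legs l ℕ.+ ∣ 1ℤ + δ ∣) offset)
                    (sym (trans (cong (distBy l true) offset) (distBy-to-leg l Sign.+ n))))
  }
... | -[1+ n ] = record
  { next        = -1ℤ + m
  ; twin        = (m , true)
  ; next-adj    = spine-edge Sign.- m
  ; twin-adj    = leg→ m
  ; twin≢next   = λ e → case cong proj₂ e of λ ()
  ; equidistant = trans (dist-along-spine j l -1ℤ m) (trans (cong (λ δ → legs l ℕ.+ ∣ -1ℤ + δ ∣) offset)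
                    (sym (trans (cong (distBy l true) offset) (distBy-to-leg l Sign.- n))))
  }

module Evader (σ : Strategy Comb 1) (admissible : Admissible Comb σ) where

  probe : (ℕ → V Comb) → ℕ → V Comb
  probe h t = lookup (σ h t) zero

  dodge-at : ∀ h t → Dodge (proj₁ (h t)) (probe h t)
  dodge-at h t = dodge (proj₁ (h t)) (probe h t)

  -- history t is the robber's run before round t, frozen from then on: the probe of round t depends only on it.
  history : ℕ → ℕ → V Comb
  history zero    = λ _ → origin
  history (suc t) = freezeAt (history t) t (Dodge.next (dodge-at (history t) t) , false)

  evader : ℕ → V Comb
  evader t = history (suc t) t

  evader-≡ : ∀ t → evader t ≡ (Dodge.next (dodge-at (history t) t) , false)
  evader-≡ t = freezeAt-≥ {f = history t} {t = t} ≤-refl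

  history-< : ∀ t {s} → s < t → history t s ≡ evader s
  history-< (suc t) {s} s<t+1 with ℕP.m<1+n⇒m<n∨m≡n s<t+1
  ... | inj₁ s<t  = trans (freezeAt-< s<t) (history-< t s<t)
  ... | inj₂ refl = refl

  anchored : ∀ t → (proj₁ (history (suc t) (suc t)) , false) ≡ evader t
  anchored t = trans (cong (λ v → proj₁ v , false) (freezeAt-≥ {f = history t} {t = t} (n≤1+n t))) (sym (evader-≡ t))

  leaves-anchor : ∀ t {w} → CombAdj (proj₁ (history (suc t) (suc t)) , false) w → Move (evader t) w
  leaves-anchor t a = inj₂ (subst (λ v → CombAdj v _) (anchored t) a)

  evader-moves : Trajectory Comb evader
  evader-moves t = subst (Move (evader t)) (sym (evader-≡ (suc t)))
                     (leaves-anchor t (Dodge.next-adj (dodge-at (history (suc t)) (suc t))))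

  history-moves : ∀ t → Trajectory Comb (history t)
  history-moves zero    _ = inj₁ refl
  history-moves (suc t) = Trajectory-freezeAt {Comb} (history-moves t) boundary
    where
    boundary : ∀ s → suc s ≡ t → Move (history t s) (Dodge.next (dodge-at (history t) t) , false)
    boundary s refl = leaves-anchor s (Dodge.next-adj (dodge-at (history (suc s)) (suc s)))

  probe-agrees : ∀ t → σ evader t ≡ σ (history t) t
  probe-agrees t = admissible evader (history t) evader-moves (history-moves t) t
    (λ s s<t _ → SameDist-≡ (sym (history-< t s<t)))

  never-caught : ∀ t → ¬ CapturedAt Comb σ evader t
  never-caught t caught =
    Dodge.twin≢next D (trans (sym shadow-now) (trans (caught shadow shadow-moves same) (evader-≡ t)))
    where
    D = dodge-at (history t) t
    shadow : ℕ → V Comb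
    shadow = freezeAt evader t (Dodge.twin D)
    shadow-now : shadow t ≡ Dodge.twin D
    shadow-now = freezeAt-≥ {f = evader} {t = t} ≤-refl
    shadow-moves : Trajectory Comb shadow
    shadow-moves = Trajectory-freezeAt {Comb} evader-moves boundary
      where
      boundary : ∀ s → suc s ≡ t → Move (evader s) (Dodge.twin D)
      boundary s refl = leaves-anchor s (Dodge.twin-adj D)
    same : Indist Comb σ evader shadow (suc t)
    same s s<t+1 zero with ℕP.m<1+n⇒m<n∨m≡n s<t+1
    ... | inj₁ s<t  = SameDist-≡ (sym (freezeAt-< {f = evader} {t = t} s<t))
    ... | inj₂ refl = ≡⇒SameDist (begin
      dist (probe evader t) (evader t)                  ≡⟨ cong₂ dist probe-now (evader-≡ t) ⟩
      dist (probe (history t) t) (Dodge.next D , false) ≡⟨ Dodge.equidistant D ⟩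
      dist (probe (history t) t) (Dodge.twin D)         ≡⟨ cong₂ dist (sym probe-now) (sym shadow-now) ⟩
      dist (probe evader t) (shadow t)                  ∎)
      where
      open ≡-Reasoning
      probe-now : probe evader t ≡ probe (history t) t
      probe-now = cong (λ ps → lookup ps zero) (probe-agrees t)

no-cops-lose : ¬ CopsWin Comb 0
no-cops-lose (σ , _ , wins) with wins (λ _ → origin) (λ _ → inj₁ refl)
... | t , caught with caught (λ _ → (+0 , true)) (λ _ → inj₁ refl) (λ _ _ ())
... | ()

one-cop-loses : ¬ CopsWin Comb 1
one-cop-loses (σ , admissible , wins) with wins (Evader.evader σ admissible) (Evader.evader-moves σ admissible)
... | t , caught = Evader.never-caught σ admissible t caught

theorem2p6 : LocallyFinite Comb × Free Comb That × IsTree Comb × LocalizationNumberIs Comb 2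
theorem2p6 = comb-locallyFinite , comb-T̂-free , (connected , comb-acyclic) , two-cops-win , fewer-lose
  where
  connected : Connected Comb
  connected u v = dist u v , dist-walk u v
  fewer-lose : ∀ j → j < 2 → ¬ CopsWin Comb j
  fewer-lose zero          _ = no-cops-lose
  fewer-lose (suc zero)    _ = one-cop-loses
  fewer-lose (suc (suc j)) (s≤s (s≤s ()))
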